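{- Let $k, s \ge 1$ be integers. Let $G$ be a graph and let $x, y \in V(G)$. Let $\mathcal B$ be a subfamily of $\mathrm{Hom}_{x,y}(C_{2k})$ satisfying $|\mathcal B| < \frac{1}{s^2}\hom_{x, y}(C_{2k})$. Then there exist walks $P_1,\dots, P_s \in \mathrm{Hom}_{x, y}(P_k)$ such that $P_iP_j\notin \mathcal B$ for every distinct $i, j \in [s]$.
   Context: In a graph $G$, $\mathrm{Hom}_{x,y}(P_k)$ is the family of walks $(x_0,x_1,\dots,x_k)$ of length $k$ with $x_0=x$, $x_k=y$ and consecutive vertices adjacent. $\mathrm{Hom}_{x,y}(C_{2k})$ is the family of closed walks $(x_1,\dots,x_{2k})$ of length $2k$ (consecutive vertices adjacent and $x_{2k}x_1$ an edge) with $x_1=x$ and $x_{k+1}=y$, and $\hom_{x,y}(C_{2k})=|\mathrm{Hom}_{x,y}(C_{2k})|$. For $P,Q\in\mathrm{Hom}_{x,y}(P_k)$, $PQ$ denotes the closed walk in $\mathrm{Hom}_{x,y}(C_{2k})$ obtained by following $P$ from $x$ to $y$ and then the reverse of $Q$ from $y$ back to $x$. -}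

module Defs where

open import Data.Nat using (ℕ; zero; suc; _+_; _∸_; _≤ᵇ_)
open import Data.Fin using (Fin; zero; suc; toℕ; fromℕ; inject₁)
open import Data.Vec using (Vec; lookup; tabulate)
open import Data.Bool using (if_then_else_)
open import Relation.Binary.PropositionalEquality using (_≡_)
open import Data.Empty using (⊥)

record Graph : Set₁ where
  field
    n      : ℕ
    E      : Fin n → Fin n → Set
    sym    : ∀ {u v} → E u v → E v u
    irrefl : ∀ {u} → E u u → ⊥

module _ (G : Graph) where
  open Graph G

  IsHomP : (k : ℕ) → Fin n → Fin n → Vec (Fin n) (suc k) → Set
  IsHomP k x y w =
    (lookup w zero ≡ x) ×' (lookup w (fromℕ k) ≡ y) ×'
    (∀ (i : Fin k) → E (lookup w (inject₁ i)) (lookup w (suc i)))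
    where
      open import Data.Product renaming (_×_ to _×'_)

  -- Hom_{x,y}(C_{2k}): closed walks (x_1,…,x_{2k}), stored as a vector of
  -- length k+k with 0-based positions (position 0 = x_1, position k = x_{k+1}).
  IsHomC : (k : ℕ) → Fin n → Fin n → Vec (Fin n) (k + k) → Set
  IsHomC k x y c =
    (∀ (i : Fin (k + k)) → toℕ i ≡ 0 → lookup c i ≡ x) ×'
    (∀ (i : Fin (k + k)) → toℕ i ≡ k → lookup c i ≡ y) ×'
    (∀ (i j : Fin (k + k)) → toℕ j ≡ suc (toℕ i) → E (lookup c i) (lookup c j)) ×'
    (∀ (i j : Fin (k + k)) → suc (toℕ i) ≡ k + k → toℕ j ≡ 0 → E (lookup c i) (lookup c j))
    where
      open import Data.Product renaming (_×_ to _×'_)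

clamp : (k : ℕ) → ℕ → Fin (suc k)
clamp zero    _       = zero
clamp (suc k) zero    = zero
clamp (suc k) (suc m) = suc (clamp k m)

-- PQ: follow P = (p_0,…,p_k) from x to y, then the reverse of Q back to x:
-- (p_0,…,p_k,q_{k-1},…,q_1), a vector of length 2k.
concatPQ : ∀ {A : Set} (k : ℕ) → Vec A (suc k) → Vec A (suc k) → Vec A (k + k)
concatPQ k P Q = tabulate λ i →
  if toℕ i ≤ᵇ k then lookup P (clamp k (toℕ i))
                 else lookup Q (clamp k ((k + k) ∸ toℕ i))

{-# OPTIONS --safe #-}

-- Let W collect the two halves of the closed walks in H; these are x–y walks of length k, and
-- (P, Q) ↦ PQ maps W × W injectively onto a superset of H, since PQ determines P and Q and
-- every closed walk is the concatenation of its halves.  Hence |H| ≤ |W|², and at most |B|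
-- pairs (P, Q) ∈ W² have PQ ∈ B.  Summing over all s-tuples from W, the number of index pairs
-- i ≠ j with P_i P_j ∈ B totals at most s(s − 1) |B| |W|^(s−2) < |W|^s, so some tuple has none.
module Submission where

open import Defs
open import Data.Nat using (ℕ; zero; suc; _+_; _*_; _∸_; _^_; _<_; _≤_; _≤ᵇ_; z≤n; s≤s; NonZero; >-nonZero)
open import Data.Nat.Properties
open import Data.Nat.Tactic.RingSolver using (solve-∀)
open import Algebra.Properties.CommutativeSemigroup +-commutativeSemigroup using (interchange)
open import Algebra.Properties.CommutativeSemigroup *-commutativeSemigroup using (xy∙z≈xz∙y)
open import Data.Bool using (true; false; T; if_then_else_)
open import Data.Fin using (Fin; zero; suc; toℕ; fromℕ; inject₁)
import Data.Fin as Fin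
open import Data.Fin.Properties using (toℕ≤pred[n]; toℕ-inject₁; toℕ-fromℕ)
open import Data.Vec using (Vec; []; _∷_; lookup; tabulate)
import Data.Vec as Vec
open import Data.Vec.Properties using (tabulate∘lookup; tabulate-cong; lookup∘tabulate; ≡-dec)
open import Data.List using (List; []; _∷_; length; map; _++_; deduplicate)
open import Data.List.Membership.Propositional using (_∈_; _∉_)
open import Data.List.Membership.Propositional.Properties
  using (∈-deduplicate⁻; ∈-deduplicate⁺; ∈-++⁻; ∈-++⁺ˡ; ∈-++⁺ʳ; ∈-map⁻; ∈-map⁺)
import Data.List.Membership.DecPropositional as DecMembership
open import Data.List.Relation.Unary.Any using (here; there)
open import Data.List.Relation.Unary.All using (All; []; _∷_)
open import Data.List.Relation.Unary.AllPairs using ([]; _∷_)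
open import Data.List.Relation.Unary.Unique.Propositional using (Unique)
open import Data.List.Relation.Unary.Unique.DecPropositional.Properties using (deduplicate-!)
open import Data.Product using (Σ; _×_; _,_; proj₁; proj₂)
open import Data.Sum using (inj₁; inj₂)
open import Function using (_∘_)
open import Function.Bundles using (_⇔_; Equivalence)
open import Relation.Nullary using (Dec; yes; no; ¬_; contradiction)
open import Relation.Binary.Definitions using (DecidableEquality)
open import Relation.Binary.PropositionalEquality

private variable A X Y : Set

m∸n≡1+[m∸1+n] : ∀ {m n} → n < m → m ∸ n ≡ suc (m ∸ suc n)
m∸n≡1+[m∸1+n] {suc m} {zero}  _         = refl
m∸n≡1+[m∸1+n] {suc m} {suc n} (s≤s n<m) = m∸n≡1+[m∸1+n] n<m

if-T : ∀ b {x y : A} → T b → (if b then x else y) ≡ x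
if-T true _ = refl

if-¬T : ∀ b {x y : A} → ¬ T b → (if b then x else y) ≡ y
if-¬T false _  = refl
if-¬T true  ¬t = contradiction _ ¬t

m*[m∸1]+2m≡[1+m]*m : ∀ m → m * (m ∸ 1) + 2 * m ≡ suc m * m
m*[m∸1]+2m≡[1+m]*m zero    = refl
m*[m∸1]+2m≡[1+m]*m (suc m) = identity m
  where
    identity : ∀ m → suc m * m + 2 * suc m ≡ suc (suc m) * suc m
    identity = solve-∀

𝟙 : ∀ {p} {P : Set p} → Dec P → ℕ
𝟙 (yes _) = 1
𝟙 (no _)  = 0

𝟙-yes : ∀ {p} {P : Set p} (d : Dec P) → P → 𝟙 d ≡ 1
𝟙-yes (yes _) _ = refl
𝟙-yes (no ¬p) p = contradiction p ¬p

𝟙≡0⇒¬ : ∀ {p} {P : Set p} (d : Dec P) → 𝟙 d ≡ 0 → ¬ P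
𝟙≡0⇒¬ (no ¬p) _ = ¬p


∑ : List X → (X → ℕ) → ℕ
∑ []       f = 0
∑ (x ∷ xs) f = f x + ∑ xs f

syntax ∑ xs (λ x → e) = ∑[ x ∈ xs ] e

∑-cong : ∀ xs {f g : X → ℕ} → (∀ x → f x ≡ g x) → ∑ xs f ≡ ∑ xs g
∑-cong []       f≡g = refl
∑-cong (x ∷ xs) f≡g = cong₂ _+_ (f≡g x) (∑-cong xs f≡g)

∑-mono-≤ : ∀ xs {f g : X → ℕ} → (∀ x → x ∈ xs → f x ≤ g x) → ∑ xs f ≤ ∑ xs g
∑-mono-≤ []       f≤g = z≤n
∑-mono-≤ (x ∷ xs) f≤g = +-mono-≤ (f≤g x (here refl)) (∑-mono-≤ xs (λ y y∈ → f≤g y (there y∈)))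

∑-distrib-+ : ∀ xs (f g : X → ℕ) → ∑[ x ∈ xs ] (f x + g x) ≡ ∑ xs f + ∑ xs g
∑-distrib-+ []       f g = refl
∑-distrib-+ (x ∷ xs) f g =
  trans (cong (f x + g x +_) (∑-distrib-+ xs f g)) (interchange (f x) (g x) (∑ xs f) (∑ xs g))

∑-distribˡ-* : ∀ c xs (f : X → ℕ) → ∑[ x ∈ xs ] (c * f x) ≡ c * ∑ xs f
∑-distribˡ-* c []       f = sym (*-zeroʳ c)
∑-distribˡ-* c (x ∷ xs) f =
  trans (cong (c * f x +_) (∑-distribˡ-* c xs f)) (sym (*-distribˡ-+ c (f x) (∑ xs f)))

∑-const : ∀ (xs : List X) c → ∑[ _ ∈ xs ] c ≡ length xs * c
∑-const []       c = refl
∑-const (x ∷ xs) c = cong (c +_) (∑-const xs c)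

∑-one : ∀ (xs : List X) → ∑[ _ ∈ xs ] 1 ≡ length xs
∑-one xs = trans (∑-const xs 1) (*-identityʳ (length xs))

∑-comm : ∀ xs (ys : List Y) (f : X → Y → ℕ) →
         ∑[ x ∈ xs ] ∑[ y ∈ ys ] f x y ≡ ∑[ y ∈ ys ] ∑[ x ∈ xs ] f x y
∑-comm []       ys f = sym (trans (∑-const ys 0) (*-zeroʳ (length ys)))
∑-comm (x ∷ xs) ys f =
  trans (cong (∑ ys (f x) +_) (∑-comm xs ys f)) (sym (∑-distrib-+ ys (f x) _))

∈⇒≤∑ : ∀ {xs} (f : X → ℕ) {x} → x ∈ xs → f x ≤ ∑ xs f
∈⇒≤∑ f (here refl) = m≤m+n _ _
∈⇒≤∑ f (there x∈)  = ≤-trans (∈⇒≤∑ f x∈) (m≤n+m _ _)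

∑<⇒∃< : ∀ xs (f : X → ℕ) M → ∑ xs f < length xs * M → Σ X λ x → x ∈ xs × f x < M
∑<⇒∃< (x ∷ xs) f M ∑<N*M with f x <? M
... | yes fx<M = x , here refl , fx<M
... | no fx≮M with ∑<⇒∃< xs f M (+-cancelˡ-< M _ _ (≤-<-trans (+-monoˡ-≤ _ (≮⇒≥ fx≮M)) ∑<N*M))
...   | y , y∈ , fy<M = y , there y∈ , fy<M

module _ (_≟_ : DecidableEquality X) where

  open DecMembership _≟_ using (_∈?_)

  count-≢ : ∀ {a xs} → All (a ≢_) xs → ∑[ x ∈ xs ] 𝟙 (a ≟ x) ≡ 0
  count-≢ []                 = refl
  count-≢ {a} (_∷_ {x} a≢x a≢xs) with a ≟ x
  ... | yes a≡x = contradiction a≡x a≢x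
  ... | no _    = count-≢ a≢xs

  count-unique : ∀ a {xs} → Unique xs → ∑[ x ∈ xs ] 𝟙 (a ≟ x) ≤ 1
  count-unique a []                      = z≤n
  count-unique a (_∷_ {x} x≢xs xs-unique) with a ≟ x
  ... | yes refl = ≤-reflexive (cong suc (count-≢ x≢xs))
  ... | no _     = count-unique a xs-unique

  𝟙-∈?≤count : ∀ a xs → 𝟙 (a ∈? xs) ≤ ∑[ x ∈ xs ] 𝟙 (a ≟ x)
  𝟙-∈?≤count a xs with a ∈? xs
  ... | no _     = z≤n
  ... | yes a∈xs = ≤-trans (≤-reflexive (sym (𝟙-yes (a ≟ a) refl))) (∈⇒≤∑ (λ x → 𝟙 (a ≟ x)) a∈xs)

module DoubleCounting (_≟X_ : DecidableEquality X) (_≟Y_ : DecidableEquality Y)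
                      (f : X → X → Y) (W : List X) where

  open DecMembership _≟Y_ using (_∈?_)

  preimages : Y → ℕ
  preimages c = ∑[ p ∈ W ] ∑[ u ∈ W ] 𝟙 (f p u ≟Y c)

  ∑-preimages : ∀ cs → ∑ cs preimages ≡ ∑[ p ∈ W ] ∑[ u ∈ W ] ∑[ c ∈ cs ] 𝟙 (f p u ≟Y c)
  ∑-preimages cs = trans (∑-comm cs W _) (∑-cong W λ p → ∑-comm cs W _)

  length-image≤ : ∀ {cs} → Unique cs →
                  (∀ c → c ∈ cs → Σ X λ p → Σ X λ u → p ∈ W × u ∈ W × f p u ≡ c) →
                  length cs ≤ length W * length W
  length-image≤ {cs} cs-unique surj = begin
    length cs                                      ≡⟨ ∑-one cs ⟨
    ∑[ _ ∈ cs ] 1                                  ≤⟨ ∑-mono-≤ cs hit ⟩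
    ∑ cs preimages                                 ≡⟨ ∑-preimages cs ⟩
    ∑[ p ∈ W ] ∑[ u ∈ W ] ∑[ c ∈ cs ] 𝟙 (f p u ≟Y c)
      ≤⟨ ∑-mono-≤ W (λ p _ → ∑-mono-≤ W λ u _ → count-unique _≟Y_ (f p u) cs-unique) ⟩
    ∑[ _ ∈ W ] ∑[ _ ∈ W ] 1                        ≡⟨ trans (∑-cong W λ _ → ∑-one W) (∑-const W _) ⟩
    length W * length W                            ∎
    where
      open ≤-Reasoning
      hit : ∀ c → c ∈ cs → 1 ≤ preimages c
      hit c c∈ with surj c c∈
      ... | p , u , p∈ , u∈ , refl = begin
        1                                ≡⟨ 𝟙-yes (f p u ≟Y f p u) refl ⟨
        𝟙 (f p u ≟Y f p u)               ≤⟨ ∈⇒≤∑ (λ v → 𝟙 (f p v ≟Y f p u)) u∈ ⟩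
        ∑[ v ∈ W ] 𝟙 (f p v ≟Y f p u)    ≤⟨ ∈⇒≤∑ (λ q → ∑[ v ∈ W ] 𝟙 (f q v ≟Y f p u)) p∈ ⟩
        preimages (f p u)                ∎

  module _ (W-unique : Unique W) (g₁ g₂ : Y → X)
           (g₁∘f : ∀ {p u} → p ∈ W → u ∈ W → g₁ (f p u) ≡ p)
           (g₂∘f : ∀ {p u} → p ∈ W → u ∈ W → g₂ (f p u) ≡ u) where

    preimages≤1 : ∀ c → preimages c ≤ 1
    preimages≤1 c = begin
      preimages c
        ≤⟨ ∑-mono-≤ W (λ p p∈ → ∑-mono-≤ W λ u u∈ → factor p∈ u∈) ⟩
      ∑[ p ∈ W ] ∑[ u ∈ W ] (𝟙 (g₁ c ≟X p) * 𝟙 (g₂ c ≟X u))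
        ≡⟨ ∑-cong W (λ p → ∑-distribˡ-* (𝟙 (g₁ c ≟X p)) W _) ⟩
      ∑[ p ∈ W ] (𝟙 (g₁ c ≟X p) * ∑[ u ∈ W ] 𝟙 (g₂ c ≟X u))
        ≤⟨ ∑-mono-≤ W (λ p _ → *-monoʳ-≤ (𝟙 (g₁ c ≟X p)) (count-unique _≟X_ (g₂ c) W-unique)) ⟩
      ∑[ p ∈ W ] (𝟙 (g₁ c ≟X p) * 1)
        ≡⟨ ∑-cong W (λ p → *-identityʳ _) ⟩
      ∑[ p ∈ W ] 𝟙 (g₁ c ≟X p)
        ≤⟨ count-unique _≟X_ (g₁ c) W-unique ⟩
      1 ∎
      where
        open ≤-Reasoning
        factor : ∀ {p u} → p ∈ W → u ∈ W → 𝟙 (f p u ≟Y c) ≤ 𝟙 (g₁ c ≟X p) * 𝟙 (g₂ c ≟X u)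
        factor {p} {u} p∈ u∈ with f p u ≟Y c
        ... | no _     = z≤n
        ... | yes refl rewrite 𝟙-yes (g₁ (f p u) ≟X p) (g₁∘f p∈ u∈)
                             | 𝟙-yes (g₂ (f p u) ≟X u) (g₂∘f p∈ u∈) = ≤-refl

    count-∈≤length : ∀ cs → ∑[ p ∈ W ] ∑[ u ∈ W ] 𝟙 (f p u ∈? cs) ≤ length cs
    count-∈≤length cs = begin
      ∑[ p ∈ W ] ∑[ u ∈ W ] 𝟙 (f p u ∈? cs)
        ≤⟨ ∑-mono-≤ W (λ p _ → ∑-mono-≤ W λ u _ → 𝟙-∈?≤count _≟Y_ (f p u) cs) ⟩
      ∑[ p ∈ W ] ∑[ u ∈ W ] ∑[ c ∈ cs ] 𝟙 (f p u ≟Y c)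
        ≡⟨ ∑-preimages cs ⟨
      ∑ cs preimages
        ≤⟨ ∑-mono-≤ cs (λ c _ → preimages≤1 c) ⟩
      ∑[ _ ∈ cs ] 1
        ≡⟨ ∑-one cs ⟩
      length cs ∎
      where open ≤-Reasoning

module FirstMoment (W : List X) where

  N : ℕ
  N = length W

  ∑ⁿ : (m : ℕ) → (Vec X m → ℕ) → ℕ
  ∑ⁿ zero    f = f []
  ∑ⁿ (suc m) f = ∑[ p ∈ W ] ∑ⁿ m (λ t → f (p ∷ t))

  ∑ⁿ-distrib-+ : ∀ m (f g : Vec X m → ℕ) → ∑ⁿ m (λ t → f t + g t) ≡ ∑ⁿ m f + ∑ⁿ m g
  ∑ⁿ-distrib-+ zero    f g = refl
  ∑ⁿ-distrib-+ (suc m) f g = trans (∑-cong W λ p → ∑ⁿ-distrib-+ m _ _) (∑-distrib-+ W _ _)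

  ∑ⁿ-const : ∀ m c → ∑ⁿ m (λ _ → c) ≡ N ^ m * c
  ∑ⁿ-const zero    c = sym (+-identityʳ c)
  ∑ⁿ-const (suc m) c = begin
    ∑[ _ ∈ W ] ∑ⁿ m (λ _ → c) ≡⟨ ∑-cong W (λ _ → ∑ⁿ-const m c) ⟩
    ∑[ _ ∈ W ] (N ^ m * c)    ≡⟨ ∑-const W _ ⟩
    N * (N ^ m * c)           ≡⟨ *-assoc N (N ^ m) c ⟨
    N ^ suc m * c             ∎
    where open ≡-Reasoning

  ∑ⁿ-cons-+ : ∀ m (a : X → Vec X m → ℕ) (f : Vec X m → ℕ) →
              ∑[ p ∈ W ] ∑ⁿ m (λ t → a p t + f t) ≡ ∑[ p ∈ W ] ∑ⁿ m (a p) + N * ∑ⁿ m f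
  ∑ⁿ-cons-+ m a f = begin
    ∑[ p ∈ W ] ∑ⁿ m (λ t → a p t + f t)     ≡⟨ ∑-cong W (λ p → ∑ⁿ-distrib-+ m (a p) f) ⟩
    ∑[ p ∈ W ] (∑ⁿ m (a p) + ∑ⁿ m f)        ≡⟨ ∑-distrib-+ W _ _ ⟩
    ∑[ p ∈ W ] ∑ⁿ m (a p) + ∑[ _ ∈ W ] ∑ⁿ m f ≡⟨ cong (∑[ p ∈ W ] ∑ⁿ m (a p) +_) (∑-const W _) ⟩
    ∑[ p ∈ W ] ∑ⁿ m (a p) + N * ∑ⁿ m f      ∎
    where open ≡-Reasoning

  ∑ⁿ<⇒∃≡0 : ∀ m (f : Vec X m → ℕ) → ∑ⁿ m f < N ^ m →
            Σ (Vec X m) λ t → (∀ i → lookup t i ∈ W) × f t ≡ 0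
  ∑ⁿ<⇒∃≡0 zero    f ∑<1 = [] , (λ ()) , n<1⇒n≡0 ∑<1
  ∑ⁿ<⇒∃≡0 (suc m) f ∑<N^[1+m] with ∑<⇒∃< W _ (N ^ m) ∑<N^[1+m]
  ... | p , p∈ , ∑<N^m with ∑ⁿ<⇒∃≡0 m (λ t → f (p ∷ t)) ∑<N^m
  ...   | t , t∈ , f[p∷t]≡0 = p ∷ t , (λ { zero → p∈ ; (suc i) → t∈ i }) , f[p∷t]≡0

  entrySum : ∀ {m} → (X → ℕ) → Vec X m → ℕ
  entrySum g t = Vec.sum (Vec.map g t)

  entrySum≡0 : ∀ {m} (g : X → ℕ) (t : Vec X m) → entrySum g t ≡ 0 → ∀ i → g (lookup t i) ≡ 0
  entrySum≡0 g (p ∷ t) ≡0 zero    = m+n≡0⇒m≡0 (g p) ≡0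
  entrySum≡0 g (p ∷ t) ≡0 (suc i) = entrySum≡0 g t (m+n≡0⇒n≡0 (g p) ≡0) i

  ∑ⁿ-entrySum : ∀ (g : X → ℕ) m → N * ∑ⁿ m (entrySum g) ≡ m * N ^ m * ∑ W g
  ∑ⁿ-entrySum g zero    = *-zeroʳ N
  ∑ⁿ-entrySum g (suc m) = begin
    N * ∑ⁿ (suc m) (entrySum g)                          ≡⟨ cong (N *_) (∑ⁿ-cons-+ m (λ p _ → g p) (entrySum g)) ⟩
    N * (∑[ p ∈ W ] ∑ⁿ m (λ _ → g p) + N * S)            ≡⟨ cong (λ e → N * (e + N * S)) (∑-cong W λ p → ∑ⁿ-const m (g p)) ⟩
    N * (∑[ p ∈ W ] (N ^ m * g p) + N * S)               ≡⟨ cong (λ e → N * (e + N * S)) (∑-distribˡ-* (N ^ m) W g) ⟩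
    N * (N ^ m * ∑ W g + N * S)                          ≡⟨ cong (λ e → N * (N ^ m * ∑ W g + e)) (∑ⁿ-entrySum g m) ⟩
    N * (N ^ m * ∑ W g + m * N ^ m * ∑ W g)              ≡⟨ regroup N (N ^ m) (∑ W g) m ⟩
    suc m * N ^ suc m * ∑ W g                            ∎
    where
      open ≡-Reasoning
      S = ∑ⁿ m (entrySum g)
      regroup : ∀ N M G m → N * (M * G + m * M * G) ≡ suc m * (N * M) * G
      regroup = solve-∀

  module _ {R : X → X → Set} (R? : ∀ p u → Dec (R p u)) where

    related : ℕ
    related = ∑[ p ∈ W ] ∑[ u ∈ W ] 𝟙 (R? p u)

    linked : X → X → ℕ
    linked p u = 𝟙 (R? p u) + 𝟙 (R? u p)

    -- The number of ordered pairs of distinct positions i, j with R (t i) (t j).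
    conflicts : ∀ {m} → Vec X m → ℕ
    conflicts []      = 0
    conflicts (p ∷ t) = entrySum (linked p) t + conflicts t

    conflicts≡0⇒unrelated : ∀ {m} (t : Vec X m) → conflicts t ≡ 0 →
                            ∀ i j → i ≢ j → ¬ R (lookup t i) (lookup t j)
    conflicts≡0⇒unrelated (p ∷ t) ≡0 zero    zero    i≢j = contradiction refl i≢j
    conflicts≡0⇒unrelated (p ∷ t) ≡0 zero    (suc j) _   =
      𝟙≡0⇒¬ (R? p _) (m+n≡0⇒m≡0 _ (entrySum≡0 (linked p) t (m+n≡0⇒m≡0 _ ≡0) j))
    conflicts≡0⇒unrelated (p ∷ t) ≡0 (suc i) zero    _   =
      𝟙≡0⇒¬ (R? _ p) (m+n≡0⇒n≡0 (𝟙 (R? p _)) (entrySum≡0 (linked p) t (m+n≡0⇒m≡0 _ ≡0) i))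
    conflicts≡0⇒unrelated (p ∷ t) ≡0 (suc i) (suc j) i≢j =
      conflicts≡0⇒unrelated t (m+n≡0⇒n≡0 _ ≡0) i j (i≢j ∘ cong suc)

    ∑-linked : ∑[ p ∈ W ] ∑ W (linked p) ≡ related + related
    ∑-linked = begin
      ∑[ p ∈ W ] ∑ W (linked p)                                         ≡⟨ ∑-cong W (λ p → ∑-distrib-+ W _ _) ⟩
      ∑[ p ∈ W ] (∑[ u ∈ W ] 𝟙 (R? p u) + ∑[ u ∈ W ] 𝟙 (R? u p))        ≡⟨ ∑-distrib-+ W _ _ ⟩
      related + ∑[ p ∈ W ] ∑[ u ∈ W ] 𝟙 (R? u p)                        ≡⟨ cong (related +_) (∑-comm W W _) ⟩
      related + related                                                 ∎
      where open ≡-Reasoning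

    ∑ⁿ-pairsWithHead : ∀ m → N * ∑[ p ∈ W ] ∑ⁿ m (entrySum (linked p)) ≡ m * N ^ m * (related + related)
    ∑ⁿ-pairsWithHead m = begin
      N * ∑[ p ∈ W ] ∑ⁿ m (entrySum (linked p))   ≡⟨ ∑-distribˡ-* N W _ ⟨
      ∑[ p ∈ W ] (N * ∑ⁿ m (entrySum (linked p))) ≡⟨ ∑-cong W (λ p → ∑ⁿ-entrySum (linked p) m) ⟩
      ∑[ p ∈ W ] (m * N ^ m * ∑ W (linked p))     ≡⟨ ∑-distribˡ-* (m * N ^ m) W _ ⟩
      m * N ^ m * ∑[ p ∈ W ] ∑ W (linked p)       ≡⟨ cong (m * N ^ m *_) ∑-linked ⟩
      m * N ^ m * (related + related)             ∎
      where open ≡-Reasoning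

    ∑ⁿ-conflicts : ∀ m → N * N * ∑ⁿ m conflicts ≡ related * N ^ m * (m * (m ∸ 1))
    ∑ⁿ-conflicts zero    = trans (*-zeroʳ (N * N)) (sym (*-zeroʳ (related * 1)))
    ∑ⁿ-conflicts (suc m) = begin
      N * N * ∑ⁿ (suc m) conflicts
        ≡⟨ cong (N * N *_) (∑ⁿ-cons-+ m (λ p → entrySum (linked p)) conflicts) ⟩
      N * N * (∑[ p ∈ W ] ∑ⁿ m (entrySum (linked p)) + N * ∑ⁿ m conflicts)
        ≡⟨ regroup N (∑[ p ∈ W ] ∑ⁿ m (entrySum (linked p))) (∑ⁿ m conflicts) ⟩
      N * (N * ∑[ p ∈ W ] ∑ⁿ m (entrySum (linked p))) + N * (N * N * ∑ⁿ m conflicts)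
        ≡⟨ cong₂ (λ a c → N * a + N * c) (∑ⁿ-pairsWithHead m) (∑ⁿ-conflicts m) ⟩
      N * (m * N ^ m * (related + related)) + N * (related * N ^ m * (m * (m ∸ 1)))
        ≡⟨ collect N (N ^ m) related m (m * (m ∸ 1)) ⟩
      related * N ^ suc m * (m * (m ∸ 1) + 2 * m)
        ≡⟨ cong (related * N ^ suc m *_) (m*[m∸1]+2m≡[1+m]*m m) ⟩
      related * N ^ suc m * (suc m * m)
        ∎
      where
        open ≡-Reasoning
        regroup : ∀ N A S → N * N * (A + N * S) ≡ N * (N * A) + N * (N * N * S)
        regroup = solve-∀
        collect : ∀ N M b m q → N * (m * M * (b + b)) + N * (b * M * q) ≡ b * (N * M) * (q + 2 * m)
        collect = solve-∀
    ∑ⁿ-conflicts<N^ : ∀ s → s * s * related < N * N → ∑ⁿ s conflicts < N ^ s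
    ∑ⁿ-conflicts<N^ s s²b<N² = *-cancelˡ-< (N * N) _ _ (begin-strict
      N * N * ∑ⁿ s conflicts           ≡⟨ ∑ⁿ-conflicts s ⟩
      related * N ^ s * (s * (s ∸ 1))  ≡⟨ xy∙z≈xz∙y related (N ^ s) (s * (s ∸ 1)) ⟩
      related * (s * (s ∸ 1)) * N ^ s  ≤⟨ *-monoˡ-≤ (N ^ s) (*-monoʳ-≤ related (*-monoʳ-≤ s (m∸n≤m s 1))) ⟩
      related * (s * s) * N ^ s        ≡⟨ cong (_* N ^ s) (*-comm related (s * s)) ⟩
      s * s * related * N ^ s          <⟨ *-monoˡ-< (N ^ s) s²b<N² ⟩
      N * N * N ^ s                    ∎)
      where
        open ≤-Reasoning
        instance
          N≢0 : NonZero N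
          N≢0 = m*n≢0⇒m≢0 N {{>-nonZero (≤-<-trans z≤n s²b<N²)}}
          N^s≢0 : NonZero (N ^ s)
          N^s≢0 = m^n≢0 N s

    ∃-unrelated-tuple : ∀ s → s * s * related < N * N →
                        Σ (Vec X s) λ t → (∀ i → lookup t i ∈ W) ×
                                          (∀ i j → i ≢ j → ¬ R (lookup t i) (lookup t j))
    ∃-unrelated-tuple s s²b<N² with ∑ⁿ<⇒∃≡0 s conflicts (∑ⁿ-conflicts<N^ s s²b<N²)
    ... | t , t∈W , ≡0 = t , t∈W , conflicts≡0⇒unrelated t ≡0

clamp-toℕ : ∀ m (j : Fin (suc m)) → clamp m (toℕ j) ≡ j
clamp-toℕ zero    zero    = refl
clamp-toℕ (suc m) zero    = refl
clamp-toℕ (suc m) (suc j) = cong suc (clamp-toℕ m j)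

toℕ-clamp : ∀ m {i} → i ≤ m → toℕ (clamp m i) ≡ i
toℕ-clamp zero    z≤n       = refl
toℕ-clamp (suc m) z≤n       = refl
toℕ-clamp (suc m) (s≤s i≤m) = cong suc (toℕ-clamp m i≤m)

-- Lookup at a natural index, clamped to the last entry, so that the index arithmetic of
-- concatPQ can be done in ℕ.
_!_ : ∀ {m} → Vec A (suc m) → ℕ → A
_!_ {m = m} v i = lookup v (clamp m i)

!-toℕ : ∀ {m} (v : Vec A (suc m)) j → lookup v j ≡ v ! toℕ j
!-toℕ {m = m} v j = cong (lookup v) (sym (clamp-toℕ m j))

!-fromℕ : ∀ {m} (v : Vec A (suc m)) → lookup v (fromℕ m) ≡ v ! m
!-fromℕ {m = m} v = trans (!-toℕ v (fromℕ m)) (cong (v !_) (toℕ-fromℕ m))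

!-ext : ∀ {m} {v w : Vec A (suc m)} → (∀ i → i ≤ m → v ! i ≡ w ! i) → v ≡ w
!-ext {v = v} {w} v≗w = begin
  v                            ≡⟨ tabulate∘lookup v ⟨
  tabulate (lookup v)          ≡⟨ tabulate-cong (λ j → trans (!-toℕ v j) (trans (v≗w (toℕ j) (toℕ≤pred[n] j)) (sym (!-toℕ w j)))) ⟩
  tabulate (lookup w)          ≡⟨ tabulate∘lookup w ⟩
  w                            ∎
  where open ≡-Reasoning

!-tabulate : ∀ {m} (g : ℕ → A) {i} → i ≤ m → tabulate {n = suc m} (g ∘ toℕ) ! i ≡ g i
!-tabulate {m = m} g i≤m = trans (lookup∘tabulate (g ∘ toℕ) _) (cong g (toℕ-clamp m i≤m))

module Halves (G : Graph) (k′ : ℕ) (x y : Fin (Graph.n G)) where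
  open Graph G using (n; E) renaming (sym to E-sym)

  k : ℕ
  k = suc k′

  -- Written so that k + k reduces to suc last.
  last : ℕ
  last = k′ + k

  k≤last : k ≤ last
  k≤last = m≤n+m k k′

  record ClosedWalk (c : Vec (Fin n) (k + k)) : Set where
    field
      start  : c ! 0 ≡ x
      middle : c ! k ≡ y
      step   : ∀ i → i < last → E (c ! i) (c ! suc i)
      close  : E (c ! last) (c ! 0)

  isHomC⇒closedWalk : ∀ c → IsHomC G k x y c → ClosedWalk c
  isHomC⇒closedWalk c (c₀≡x , cₖ≡y , steps , closing) = record
    { start  = c₀≡x _ (toℕ-clamp last z≤n)
    ; middle = cₖ≡y _ (toℕ-clamp last k≤last)
    ; step   = λ i i<last → steps _ _
        (trans (toℕ-clamp last i<last) (cong suc (sym (toℕ-clamp last (<⇒≤ i<last)))))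
    ; close  = closing _ _ (cong suc (toℕ-clamp last ≤-refl)) (toℕ-clamp last z≤n)
    }

  isHomP⇒endpoints : ∀ w → IsHomP G k x y w → w ! 0 ≡ x × w ! k ≡ y
  isHomP⇒endpoints w (w₀≡x , wₖ≡y , _) = w₀≡x , trans (sym (!-fromℕ w)) wₖ≡y

  isHomP⁺ : ∀ w → w ! 0 ≡ x → w ! k ≡ y → (∀ i → i < k → E (w ! i) (w ! suc i)) → IsHomP G k x y w
  isHomP⁺ w w₀≡x wₖ≡y steps = w₀≡x , trans (!-fromℕ w) wₖ≡y , λ i →
    subst₂ E (sym (trans (!-toℕ w (inject₁ i)) (cong (w !_) (toℕ-inject₁ i)))) (sym (!-toℕ w (suc i)))
             (steps (toℕ i) (s≤s (toℕ≤pred[n] i)))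

  concatPQ-entry : Vec A (suc k) → Vec A (suc k) → ℕ → A
  concatPQ-entry P Q i = if i ≤ᵇ k then P ! i else Q ! (k + k ∸ i)

  concatPQ-!ˡ : ∀ (P Q : Vec A (suc k)) {i} → i ≤ k → concatPQ k P Q ! i ≡ P ! i
  concatPQ-!ˡ P Q {i} i≤k =
    trans (!-tabulate (concatPQ-entry P Q) (≤-trans i≤k k≤last)) (if-T (i ≤ᵇ k) (≤⇒≤ᵇ i≤k))

  concatPQ-!ʳ : ∀ (P Q : Vec A (suc k)) {i} → k < i → i ≤ last → concatPQ k P Q ! i ≡ Q ! (k + k ∸ i)
  concatPQ-!ʳ P Q {i} k<i i≤last =
    trans (!-tabulate (concatPQ-entry P Q) i≤last) (if-¬T (i ≤ᵇ k) (<⇒≱ k<i ∘ ≤ᵇ⇒≤ i k))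

  -- The position of q_i in PQ; q₀ = x sits at position 0, not at k + k.
  mirror : ℕ → ℕ
  mirror zero    = zero
  mirror (suc i) = k + k ∸ suc i

  firstHalf : Vec A (k + k) → Vec A (suc k)
  firstHalf c = tabulate (λ j → c ! toℕ j)

  secondHalf : Vec A (k + k) → Vec A (suc k)
  secondHalf c = tabulate (λ j → c ! mirror (toℕ j))

  firstHalf-! : ∀ (c : Vec A (k + k)) {i} → i ≤ k → firstHalf c ! i ≡ c ! i
  firstHalf-! c = !-tabulate (c !_)

  secondHalf-! : ∀ (c : Vec A (k + k)) {i} → i ≤ k → secondHalf c ! i ≡ c ! mirror i
  secondHalf-! c = !-tabulate (λ i → c ! mirror i)

  mirror-pos : ∀ {i} → 0 < i → mirror i ≡ k + k ∸ i
  mirror-pos {suc i} _ = refl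

  k+k∸k≡k : k + k ∸ k ≡ k
  k+k∸k≡k = m+n∸n≡m k k

  firstHalf-isHomP : ∀ {c} → ClosedWalk c → IsHomP G k x y (firstHalf c)
  firstHalf-isHomP {c} walk = isHomP⁺ (firstHalf c)
    (trans (firstHalf-! c z≤n) start)
    (trans (firstHalf-! c ≤-refl) middle)
    (λ i i<k → subst₂ E (sym (firstHalf-! c (<⇒≤ i<k))) (sym (firstHalf-! c i<k))
                        (step i (≤-trans i<k k≤last)))
    where open ClosedWalk walk

  secondHalf-isHomP : ∀ {c} → ClosedWalk c → IsHomP G k x y (secondHalf c)
  secondHalf-isHomP {c} walk = isHomP⁺ (secondHalf c)
    (trans (secondHalf-! c z≤n) start)
    (trans (secondHalf-! c ≤-refl) (trans (cong (c !_) k+k∸k≡k) middle))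
    (λ i i<k → subst₂ E (sym (secondHalf-! c (<⇒≤ i<k))) (sym (secondHalf-! c i<k)) (reversed-step i i<k))
    where
      open ClosedWalk walk
      reversed-step : ∀ i → i < k → E (c ! mirror i) (c ! mirror (suc i))
      reversed-step zero     _   = E-sym close
      reversed-step (suc i) 1+i<k =
        subst (λ p → E (c ! p) (c ! j)) (sym k+k∸[1+i]≡1+j) (E-sym (step j j<last))
        where
          j = k + k ∸ suc (suc i)
          k+k∸[1+i]≡1+j : k + k ∸ suc i ≡ suc j
          k+k∸[1+i]≡1+j = m∸n≡1+[m∸1+n] (≤-trans 1+i<k (m≤m+n k k))
          j<last : j < last
          j<last = subst (_≤ last) k+k∸[1+i]≡1+j (∸-monoʳ-≤ {m = 1} {n = suc i} (k + k) (s≤s z≤n))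

  firstHalf-concatPQ : ∀ (P Q : Vec A (suc k)) → firstHalf (concatPQ k P Q) ≡ P
  firstHalf-concatPQ P Q = !-ext λ i i≤k → trans (firstHalf-! (concatPQ k P Q) i≤k) (concatPQ-!ˡ P Q i≤k)

  secondHalf-concatPQ : ∀ P Q → IsHomP G k x y P → IsHomP G k x y Q → secondHalf (concatPQ k P Q) ≡ Q
  secondHalf-concatPQ P Q P-walk Q-walk = !-ext λ i i≤k →
    trans (secondHalf-! (concatPQ k P Q) i≤k) (entry i i≤k)
    where
      PQ = concatPQ k P Q
      entry : ∀ i → i ≤ k → PQ ! mirror i ≡ Q ! i
      entry zero _ =
        trans (concatPQ-!ˡ P Q z≤n) (trans (proj₁ (isHomP⇒endpoints P P-walk)) (sym (proj₁ (isHomP⇒endpoints Q Q-walk))))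
      entry (suc i) 1+i≤k with m≤n⇒m<n∨m≡n 1+i≤k
      ... | inj₂ refl = trans (cong (PQ !_) k+k∸k≡k) (trans (concatPQ-!ˡ P Q ≤-refl)
              (trans (proj₂ (isHomP⇒endpoints P P-walk)) (sym (proj₂ (isHomP⇒endpoints Q Q-walk)))))
      ... | inj₁ 1+i<k = trans (concatPQ-!ʳ P Q k<k+k∸[1+i] (∸-monoʳ-≤ {m = 1} {n = suc i} (k + k) (s≤s z≤n)))
                               (cong (Q !_) (m∸[m∸n]≡n (≤-trans 1+i≤k (m≤m+n k k))))
        where
          k<k+k∸[1+i] : k < k + k ∸ suc i
          k<k+k∸[1+i] = subst (k <_) (sym (+-∸-assoc k (<⇒≤ 1+i<k))) (m<m+n k (m<n⇒0<n∸m 1+i<k))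

  concatPQ-halves : ∀ (c : Vec A (k + k)) → concatPQ k (firstHalf c) (secondHalf c) ≡ c
  concatPQ-halves c = !-ext entry
    where
      entry : ∀ i → i ≤ last → concatPQ k (firstHalf c) (secondHalf c) ! i ≡ c ! i
      entry i i≤last with i ≤? k
      ... | yes i≤k = trans (concatPQ-!ˡ (firstHalf c) (secondHalf c) i≤k) (firstHalf-! c i≤k)
      ... | no  i≰k = begin
        concatPQ k (firstHalf c) (secondHalf c) ! i ≡⟨ concatPQ-!ʳ (firstHalf c) (secondHalf c) (≰⇒> i≰k) i≤last ⟩
        secondHalf c ! (k + k ∸ i)                  ≡⟨ secondHalf-! c k+k∸i≤k ⟩
        c ! mirror (k + k ∸ i)                      ≡⟨ cong (c !_) (mirror-pos (m<n⇒0<n∸m (s≤s i≤last))) ⟩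
        c ! (k + k ∸ (k + k ∸ i))                   ≡⟨ cong (c !_) (m∸[m∸n]≡n (m≤n⇒m≤1+n i≤last)) ⟩
        c ! i                                       ∎
        where
          open ≡-Reasoning
          k+k∸i≤k : k + k ∸ i ≤ k
          k+k∸i≤k = subst (k + k ∸ i ≤_) k+k∸k≡k (∸-monoʳ-≤ (k + k) (<⇒≤ (≰⇒> i≰k)))

  _≟ᵥ_ : DecidableEquality (Vec (Fin n) (suc k))
  _≟ᵥ_ = ≡-dec Fin._≟_

  _≟ᶜ_ : DecidableEquality (Vec (Fin n) (k + k))
  _≟ᶜ_ = ≡-dec Fin._≟_

  open DecMembership _≟ᶜ_ using (_∈?_) public

  module HalvesOf (H : List (Vec (Fin n) (k + k))) (H-closed : ∀ {c} → c ∈ H → IsHomC G k x y c) where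

    W : List (Vec (Fin n) (suc k))
    W = deduplicate _≟ᵥ_ (map firstHalf H ++ map secondHalf H)

    firstHalf∈W : ∀ {c} → c ∈ H → firstHalf c ∈ W
    firstHalf∈W c∈H = ∈-deduplicate⁺ _≟ᵥ_ (∈-++⁺ˡ (∈-map⁺ firstHalf c∈H))

    secondHalf∈W : ∀ {c} → c ∈ H → secondHalf c ∈ W
    secondHalf∈W c∈H = ∈-deduplicate⁺ _≟ᵥ_ (∈-++⁺ʳ (map firstHalf H) (∈-map⁺ secondHalf c∈H))

    W⇒isHomP : ∀ {p} → p ∈ W → IsHomP G k x y p
    W⇒isHomP p∈W with ∈-++⁻ (map firstHalf H) (∈-deduplicate⁻ _≟ᵥ_ _ p∈W)
    ... | inj₁ p∈ with ∈-map⁻ firstHalf p∈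
    ...   | c , c∈H , refl = firstHalf-isHomP (isHomC⇒closedWalk c (H-closed c∈H))
    W⇒isHomP p∈W | inj₂ p∈ with ∈-map⁻ secondHalf p∈
    ...   | c , c∈H , refl = secondHalf-isHomP (isHomC⇒closedWalk c (H-closed c∈H))

    open DoubleCounting _≟ᵥ_ _≟ᶜ_ (concatPQ k) W
    open FirstMoment W using (N; related)

    length≤N² : Unique H → length H ≤ N * N
    length≤N² H-unique = length-image≤ H-unique λ c c∈H →
      firstHalf c , secondHalf c , firstHalf∈W c∈H , secondHalf∈W c∈H , concatPQ-halves c

    related≤length : ∀ B → related (λ p u → concatPQ k p u ∈? B) ≤ length B
    related≤length = count-∈≤length (deduplicate-! _≟ᵥ_ _) firstHalf secondHalf
      (λ {p} {u} _ _ → firstHalf-concatPQ p u)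
      (λ {p} {u} p∈W u∈W → secondHalf-concatPQ p u (W⇒isHomP p∈W) (W⇒isHomP u∈W))


lemma17 : (k s : ℕ) → 1 ≤ k → 1 ≤ s → (G : Graph) → (x y : Fin (Graph.n G)) →
    (H : List (Vec (Fin (Graph.n G)) (k + k))) → Unique H →
    (∀ c → (c ∈ H) ⇔ IsHomC G k x y c) →
    (B : List (Vec (Fin (Graph.n G)) (k + k))) → Unique B →
    All (IsHomC G k x y) B →
    (s * s) * length B < length H →
    Σ (Vec (Vec (Fin (Graph.n G)) (suc k)) s) λ Ps →
    (∀ i → IsHomP G k x y (lookup Ps i)) ×
    (∀ i j → i ≢ j → concatPQ k (lookup Ps i) (lookup Ps j) ∉ B)
lemma17 (suc k′) s (s≤s z≤n) _ G x y H H-unique H⇔closed B _ _ s²B<H =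
  let Ps , Ps∈W , unrelated = ∃-unrelated-tuple (λ p u → concatPQ k p u ∈? B) s s²related<N²
  in  Ps , W⇒isHomP ∘ Ps∈W , unrelated
  where
    open Halves G k′ x y
    open HalvesOf H (Equivalence.to (H⇔closed _))
    open FirstMoment W
    s²related<N² : s * s * related (λ p u → concatPQ k p u ∈? B) < N * N
    s²related<N² = ≤-<-trans (*-monoʳ-≤ (s * s) (related≤length B)) (<-≤-trans s²B<H (length≤N² H-unique))
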